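{- Let $M=(E,\mathcal{B})$ be a matroid of rank $r$, let $\nu\in\mathscr{D}(M)$, and let $(S,ab,cd)\in Z(r,E)$. If $Sab\notin\mathcal{B}$, then $(S,ab,cd)\in[\overline{\nu}]$.
   Context: For $\nu:\mathcal{B}\to\mathbb{R}$, $\overline{\nu}:\binom{E}{r}\to\mathbb{R}\cup\{\infty\}$ extends $\nu$ by $\infty$ outside $\mathcal{B}$; $\nu$ is a valuation of $M$ if for all $B,B'\in\binom{E}{r}$ and $e\in B\setminus B'$ there is $f\in B'\setminus B$ with $\overline{\nu}(B)+\overline{\nu}(B')\geq\overline{\nu}(B-e+f)+\overline{\nu}(B'+e-f)$; $\mathscr{D}(M)$ is the set of valuations of $M$. $Z(r,E)$ is the set of triples $(S,ab,cd)$ with $S\in\binom{E}{r-2}$ and $a,b,c,d\in E\setminus S$ distinct; $Sab:=S\cup\{a,b\}$ etc. $[\overline{\nu}]:=\{(S,ab,cd)\in Z(r,E):\overline{\nu}(Sac)+\overline{\nu}(Sbd)=\overline{\nu}(Sad)+\overline{\nu}(Sbc)\}$ (with $\infty=\infty$ counting as equality). -}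

module Defs where

open import Level using (Level; suc; _⊔_)
open import Data.Nat using (ℕ; _+_)
open import Data.Bool using (Bool; true; false)
open import Data.Fin using (Fin)
open import Data.Fin.Subset using (Subset; _∈_; _∉_; _∪_; _-_; ⁅_⁆; ∣_∣)
open import Data.Product using (Σ; ∃; _×_; _,_)
open import Data.Unit using (⊤)
open import Data.Empty using (⊥)
open import Relation.Binary.PropositionalEquality using (_≡_)
open import Relation.Binary.Structures using (IsTotalOrder)
open import Relation.Nullary using (¬_)
open import Algebra.Structures using (IsAbelianGroup)

record OrderedAbelianGroup (c ℓ : Level) : Set (Level.suc (c ⊔ ℓ)) where
  infixl 6 _+ᴳ_
  infix 4 _≤ᴳ_
  field
    Carrier         : Set c
    _+ᴳ_            : Carrier → Carrier → Carrier
    0ᴳ              : Carrier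
    -ᴳ_             : Carrier → Carrier
    _≤ᴳ_            : Carrier → Carrier → Set ℓ
    isAbelianGroup  : IsAbelianGroup _≡_ _+ᴳ_ 0ᴳ -ᴳ_
    isTotalOrder    : IsTotalOrder _≡_ _≤ᴳ_
    +-monoˡ         : ∀ {x y} z → x ≤ᴳ y → x +ᴳ z ≤ᴳ y +ᴳ z

swap : ∀ {n} → Subset n → Fin n → Fin n → Subset n
swap B e f = (B - e) ∪ ⁅ f ⁆

record Matroid (n : ℕ) : Set where
  field
    isBasis  : Subset n → Bool
    nonempty : ∃ λ B → isBasis B ≡ true
    exchange : ∀ B B' → isBasis B ≡ true → isBasis B' ≡ true →
               ∀ e → e ∈ B → e ∉ B' →
               ∃ λ f → f ∈ B' × f ∉ B × isBasis (swap B e f) ≡ true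
open Matroid public

HasRank : ∀ {n} → Matroid n → ℕ → Set
HasRank M r = ∀ B → isBasis M B ≡ true → ∣ B ∣ ≡ r

module Extended {c ℓ} (G : OrderedAbelianGroup c ℓ) where
  open OrderedAbelianGroup G

  data G∞ : Set c where
    fin : Carrier → G∞
    ∞   : G∞

  infixl 6 _+∞_
  _+∞_ : G∞ → G∞ → G∞
  fin x +∞ fin y = fin (x +ᴳ y)
  fin x +∞ ∞     = ∞
  ∞     +∞ _     = ∞

  infix 4 _≤∞_
  _≤∞_ : G∞ → G∞ → Set ℓ
  fin x ≤∞ fin y = x ≤ᴳ y
  fin x ≤∞ ∞     = Level.Lift ℓ ⊤
  ∞     ≤∞ fin y = Level.Lift ℓ ⊥
  ∞     ≤∞ ∞     = Level.Lift ℓ ⊤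

  ext : ∀ {n} → Matroid n → (Subset n → Carrier) → Subset n → G∞
  ext M ν B with isBasis M B
  ... | true  = fin (ν B)
  ... | false = ∞

  IsValuation : ∀ {n} → (M : Matroid n) → ℕ → (Subset n → Carrier) → Set ℓ
  IsValuation {n} M r ν =
    ∀ (B B' : Subset n) → ∣ B ∣ ≡ r → ∣ B' ∣ ≡ r →
    ∀ e → e ∈ B → e ∉ B' →
    ∃ λ f → f ∈ B' × f ∉ B ×
      (ext M ν (swap B e f) +∞ ext M ν (swap B' f e) ≤∞ ext M ν B +∞ ext M ν B')

  InZ : ∀ {n} → ℕ → Subset n → Fin n → Fin n → Fin n → Fin n → Set
  InZ r S a b c d =
    ∣ S ∣ + 2 ≡ r ×
    (a ∉ S × b ∉ S × c ∉ S × d ∉ S) ×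
    (¬ a ≡ b × ¬ a ≡ c × ¬ a ≡ d × ¬ b ≡ c × ¬ b ≡ d × ¬ c ≡ d)

  _⟨_,_⟩ : ∀ {n} → Subset n → Fin n → Fin n → Subset n
  S ⟨ x , y ⟩ = S ∪ ⁅ x ⁆ ∪ ⁅ y ⁆

  InBracket : ∀ {n} → Matroid n → (Subset n → Carrier) →
              Subset n → Fin n → Fin n → Fin n → Fin n → Set c
  InBracket M ν S a b c d =
    ext M ν (S ⟨ a , c ⟩) +∞ ext M ν (S ⟨ b , d ⟩)
      ≡ ext M ν (S ⟨ a , d ⟩) +∞ ext M ν (S ⟨ b , c ⟩)

-- If S∪{a,d} and S∪{b,c} are bases, the valuated exchange
-- axiom applied to them with e = d supplies f ∈ {b, c}; f = b would bound the infinite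
-- value at S∪{a,b} by a finite one, so f = c, which is the inequality
-- ν̄(Sac) + ν̄(Sbd) ≤ ν̄(Sad) + ν̄(Sbc). If one of them is not a basis the right-hand side
-- is ∞ and the inequality is trivial. Exchanging the roles of c and d gives the reverse
-- inequality.
module Submission where

open import Defs
open import Level using (Level; lower)
open import Data.Nat using (ℕ)
open import Data.Bool using (false; true)
open import Data.Fin using (Fin)
open import Data.Fin.Subset using (Subset; _∈_; _∉_; _∪_; _─_; ⁅_⁆; inside; outside)
open import Data.Fin.Subset.Properties
  using (x∈p∪q⁻; x∈p∪q⁺; x∈⁅x⁆; x∈⁅y⁆⇒x≡y; ⊆-antisym; p─q⊆p; x∈p∧x≢y⇒x∈p-y)
open import Data.Vec.Base using (_∷_; here; there)
open import Data.Product using (_,_)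
open import Data.Sum using (_⊎_; inj₁; inj₂)
open import Data.Empty using (⊥-elim)
open import Function using (_∘_)
open import Relation.Binary.PropositionalEquality using (_≡_; _≢_; refl; sym; cong)
open import Relation.Binary.Structures using (IsTotalOrder)

x∈p─q⇒x∉q : ∀ {n} {p q : Subset n} {x} → x ∈ p ─ q → x ∉ q
x∈p─q⇒x∉q {p = inside ∷ p} {outside ∷ q} here ()
x∈p─q⇒x∉q {p = _ ∷ p} {_ ∷ q} (there x∈p─q) (there x∈q) = x∈p─q⇒x∉q x∈p─q x∈q

module _ {n : ℕ} (S : Subset n) {x y : Fin n} where

  ∈-∪-pair⁻ : ∀ {i} → i ∈ S ∪ ⁅ x ⁆ ∪ ⁅ y ⁆ → i ∈ S ⊎ i ≡ x ⊎ i ≡ y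
  ∈-∪-pair⁻ i∈ with x∈p∪q⁻ S _ i∈
  ... | inj₁ i∈S = inj₁ i∈S
  ... | inj₂ i∈xy with x∈p∪q⁻ ⁅ x ⁆ ⁅ y ⁆ i∈xy
  ... | inj₁ i∈x = inj₂ (inj₁ (x∈⁅y⁆⇒x≡y x i∈x))
  ... | inj₂ i∈y = inj₂ (inj₂ (x∈⁅y⁆⇒x≡y y i∈y))

  ∈-∪-pair⁺ˡ : ∀ {i} → i ∈ S → i ∈ S ∪ ⁅ x ⁆ ∪ ⁅ y ⁆
  ∈-∪-pair⁺ˡ = x∈p∪q⁺ ∘ inj₁

  x∈-∪-pair : x ∈ S ∪ ⁅ x ⁆ ∪ ⁅ y ⁆
  x∈-∪-pair = x∈p∪q⁺ (inj₂ (x∈p∪q⁺ (inj₁ (x∈⁅x⁆ x))))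

  y∈-∪-pair : y ∈ S ∪ ⁅ x ⁆ ∪ ⁅ y ⁆
  y∈-∪-pair = x∈p∪q⁺ (inj₂ (x∈p∪q⁺ (inj₂ (x∈⁅x⁆ y))))

  ∉-∪-pair : ∀ {i} → i ∉ S → i ≢ x → i ≢ y → i ∉ S ∪ ⁅ x ⁆ ∪ ⁅ y ⁆
  ∉-∪-pair i∉S i≢x i≢y i∈ with ∈-∪-pair⁻ i∈
  ... | inj₁ i∈S = i∉S i∈S
  ... | inj₂ (inj₁ i≡x) = i≢x i≡x
  ... | inj₂ (inj₂ i≡y) = i≢y i≡y

swap-∪-pair : ∀ {n} (S : Subset n) {x y z : Fin n} → y ∉ S → x ≢ y →
              swap (S ∪ ⁅ x ⁆ ∪ ⁅ y ⁆) y z ≡ S ∪ ⁅ x ⁆ ∪ ⁅ z ⁆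
swap-∪-pair S {x} {y} {z} y∉S x≢y = ⊆-antisym ⊆-pair pair-⊆
  where
  ⊆-pair : ∀ {i} → i ∈ swap (S ∪ ⁅ x ⁆ ∪ ⁅ y ⁆) y z → i ∈ S ∪ ⁅ x ⁆ ∪ ⁅ z ⁆
  ⊆-pair i∈ with x∈p∪q⁻ (S ∪ ⁅ x ⁆ ∪ ⁅ y ⁆ ─ ⁅ y ⁆) ⁅ z ⁆ i∈
  ... | inj₂ i∈z rewrite x∈⁅y⁆⇒x≡y z i∈z = y∈-∪-pair S
  ... | inj₁ i∈Sxy-y with ∈-∪-pair⁻ S (p─q⊆p _ ⁅ y ⁆ i∈Sxy-y)
  ... | inj₁ i∈S = ∈-∪-pair⁺ˡ S i∈S
  ... | inj₂ (inj₁ refl) = x∈-∪-pair S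
  ... | inj₂ (inj₂ refl) = ⊥-elim (x∈p─q⇒x∉q i∈Sxy-y (x∈⁅x⁆ y))

  pair-⊆ : ∀ {i} → i ∈ S ∪ ⁅ x ⁆ ∪ ⁅ z ⁆ → i ∈ swap (S ∪ ⁅ x ⁆ ∪ ⁅ y ⁆) y z
  pair-⊆ i∈ with ∈-∪-pair⁻ S i∈
  ... | inj₁ i∈S = x∈p∪q⁺ (inj₁ (x∈p∧x≢y⇒x∈p-y (∈-∪-pair⁺ˡ S i∈S) λ { refl → y∉S i∈S }))
  ... | inj₂ (inj₁ refl) = x∈p∪q⁺ (inj₁ (x∈p∧x≢y⇒x∈p-y (x∈-∪-pair S) x≢y))
  ... | inj₂ (inj₂ refl) = x∈p∪q⁺ (inj₂ (x∈⁅x⁆ z))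

module _ {o ℓ : Level} (G : OrderedAbelianGroup o ℓ) where
  open OrderedAbelianGroup G
  open Extended G

  ≤∞-antisym : ∀ {x y} → x ≤∞ y → y ≤∞ x → x ≡ y
  ≤∞-antisym {fin x} {fin y} x≤y y≤x = cong fin (IsTotalOrder.antisym isTotalOrder x≤y y≤x)
  ≤∞-antisym {∞} {∞} _ _ = refl

  ≤∞-∞ : ∀ x → x ≤∞ ∞
  ≤∞-∞ (fin x) = _
  ≤∞-∞ ∞ = _

  module _ {n : ℕ} (M : Matroid n) (ν : Subset n → Carrier) where

    ext-basis : ∀ {B} → isBasis M B ≡ true → ext M ν B ≡ fin (ν B)
    ext-basis B∈ℬ rewrite B∈ℬ = refl

    ext-nonbasis : ∀ {B} → isBasis M B ≡ false → ext M ν B ≡ ∞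
    ext-nonbasis B∉ℬ rewrite B∉ℬ = refl

    exchange-≤-bases : ∀ {r} → HasRank M r → IsValuation M r ν →
      ∀ {S a b c d} → c ∉ S → d ∉ S → a ≢ d → b ≢ c → b ≢ d → c ≢ d →
      ext M ν (S ⟨ a , b ⟩) ≡ ∞ →
      isBasis M (S ⟨ a , d ⟩) ≡ true → isBasis M (S ⟨ b , c ⟩) ≡ true →
      ext M ν (S ⟨ a , c ⟩) +∞ ext M ν (S ⟨ b , d ⟩) ≤∞ fin (ν (S ⟨ a , d ⟩)) +∞ fin (ν (S ⟨ b , c ⟩))
    exchange-≤-bases rank val {S} {a} {b} {c} {d} c∉S d∉S a≢d b≢c b≢d c≢d Sab=∞ Sad∈ℬ Sbc∈ℬ
      with val (S ⟨ a , d ⟩) (S ⟨ b , c ⟩) (rank _ Sad∈ℬ) (rank _ Sbc∈ℬ)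
               d (y∈-∪-pair S) (∉-∪-pair S d∉S (b≢d ∘ sym) (c≢d ∘ sym))
    ... | f , f∈Sbc , f∉Sad , exchanged with ∈-∪-pair⁻ S f∈Sbc
    ... | inj₁ f∈S = ⊥-elim (f∉Sad (∈-∪-pair⁺ˡ S f∈S))
    ... | inj₂ (inj₁ refl) rewrite swap-∪-pair S {z = f} d∉S a≢d | Sab=∞
                                 | ext-basis Sad∈ℬ | ext-basis Sbc∈ℬ = ⊥-elim (lower exchanged)
    ... | inj₂ (inj₂ refl) rewrite swap-∪-pair S {z = f} d∉S a≢d
                                 | swap-∪-pair S {z = d} c∉S b≢c
                                 | ext-basis Sad∈ℬ | ext-basis Sbc∈ℬ = exchanged

    exchange-≤ : ∀ {r} → HasRank M r → IsValuation M r ν →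
      ∀ {S a b c d} → c ∉ S → d ∉ S → a ≢ d → b ≢ c → b ≢ d → c ≢ d →
      ext M ν (S ⟨ a , b ⟩) ≡ ∞ →
      ext M ν (S ⟨ a , c ⟩) +∞ ext M ν (S ⟨ b , d ⟩) ≤∞ ext M ν (S ⟨ a , d ⟩) +∞ ext M ν (S ⟨ b , c ⟩)
    exchange-≤ rank val {S} {a} {b} {c} {d} c∉S d∉S a≢d b≢c b≢d c≢d Sab=∞
      with isBasis M (S ⟨ a , d ⟩) in Sad∈ℬ | isBasis M (S ⟨ b , c ⟩) in Sbc∈ℬ
    ... | true  | true  = exchange-≤-bases rank val c∉S d∉S a≢d b≢c b≢d c≢d Sab=∞ Sad∈ℬ Sbc∈ℬ
    ... | false | _     = ≤∞-∞ (ext M ν (S ⟨ a , c ⟩) +∞ ext M ν (S ⟨ b , d ⟩))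
    ... | true  | false = ≤∞-∞ (ext M ν (S ⟨ a , c ⟩) +∞ ext M ν (S ⟨ b , d ⟩))

lemma1 : ∀ {c ℓ : Level} (G : OrderedAbelianGroup c ℓ) {n : ℕ}
           (M : Matroid n) (r : ℕ) → HasRank M r →
           (ν : Subset n → OrderedAbelianGroup.Carrier G) →
           Extended.IsValuation G M r ν →
           (S : Subset n) (a b c d : Fin n) →
           Extended.InZ G r S a b c d →
           isBasis M (Extended._⟨_,_⟩ G S a b) ≡ false →
           Extended.InBracket G M ν S a b c d
lemma1 G M r rank ν val S a b c d
       (_ , (_ , _ , c∉S , d∉S) , (_ , a≢c , a≢d , b≢c , b≢d , c≢d)) Sab∉ℬ =
  ≤∞-antisym G
    (exchange-≤ G M ν rank val c∉S d∉S a≢d b≢c b≢d c≢d Sab=∞)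
    (exchange-≤ G M ν rank val d∉S c∉S a≢c b≢d b≢c (c≢d ∘ sym) Sab=∞)
  where
  open Extended G using (ext; ∞; _⟨_,_⟩)
  Sab=∞ : ext M ν (S ⟨ a , b ⟩) ≡ ∞
  Sab=∞ = ext-nonbasis G M ν Sab∉ℬ
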